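{- Let $G$ be a graph, let $B$ be a proper block of $G$, and let $b_1,b_2,b_3\in B$ be pairwise distinct. Then $B$ is the set of all $v\in V(G)$ such that there is no set $S\subseteq V(G)\setminus\{v\}$ with $|S|\le 2$ separating $v$ from $\{b_1,b_2,b_3\}$.
   Context: Graphs are finite, simple, undirected. A set $S$ (with $v\notin S$) separates $v$ from a set $X$ if every path from $v$ to a vertex of $X$ contains a vertex of $S$. For a subgraph $C$, $N_G(C)$ is the set of vertices outside $V(C)$ adjacent to a vertex of $C$. For $X\subseteq V(G)$, the torso $G\llbracket X\rrbracket$ has vertex set $X$, with distinct $v,w\in X$ adjacent iff $vw\in E(G)$ or $v,w\in N_G(C)$ for some connected component $C$ of $G\setminus X$; the adhesion of $X$ is the maximum of $|N_G(C)|$ over connected components $C$ of $G\setminus X$. A graph is 3-connected if it has more than 3 vertices and removing at most 2 vertices leaves it connected. A proper block of $G$ is a set $B\subseteq V(G)$ such that $G\llbracket B\rrbracket$ is 3-connected and $B$ has adhesion at most $2$. -}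

module Defs where

open import Data.Nat using (ℕ; _≤_; _<_)
open import Data.Fin using (Fin)
open import Data.Fin.Subset using (Subset; _∈_; _∉_; ∣_∣; _∩_; ∁)
open import Data.Fin.Subset.Properties using (_∈?_)
open import Data.Fin.Properties using (any?)
open import Data.Vec using (tabulate)
open import Data.List using (List; []; _∷_)
open import Data.List.Relation.Unary.All using (All)
open import Data.List.Relation.Unary.Any using (Any)
open import Data.List.Relation.Unary.Unique.Propositional using (Unique)
open import Data.Product using (Σ; ∃; _×_; _,_)
open import Data.Sum using (_⊎_)
open import Relation.Nullary using (¬_; Dec)
open import Relation.Nullary.Decidable using (⌊_⌋; _×-dec_; ¬?)
open import Relation.Binary.PropositionalEquality using (_≡_; _≢_)

record Graph (n : ℕ) : Set₁ where
  field
    _~_    : Fin n → Fin n → Set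
    _~?_   : ∀ u v → Dec (u ~ v)
    ~-sym  : ∀ {u v} → u ~ v → v ~ u
    ~-irr  : ∀ {u} → ¬ (u ~ u)

module _ {n : ℕ} where

  data Walk (R : Fin n → Fin n → Set) : Fin n → Fin n → Set where
    []  : ∀ {u} → Walk R u u
    _∷_ : ∀ {u v w} → R u v → Walk R v w → Walk R u w

  verts : ∀ {R u w} → Walk R u w → List (Fin n)
  verts {u = u} []       = u ∷ []
  verts {u = u} (_ ∷ p)  = u ∷ verts p

  IsPath : ∀ {R u w} → Walk R u w → Set
  IsPath p = Unique (verts p)

  Connected : (Fin n → Fin n → Set) → Subset n → Set
  Connected R U = ∀ u w → u ∈ U → w ∈ U →
    Σ (Walk R u w) λ p → IsPath p × All (_∈ U) (verts p)

  module _ (G : Graph n) where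
    open Graph G

    Separates : Subset n → Fin n → Subset n → Set
    Separates S v X = v ∉ S × (∀ x → x ∈ X → (p : Walk _~_ v x) → IsPath p → Any (_∈ S) (verts p))

    IsComponent : Subset n → Subset n → Set
    IsComponent X C =
      (∃ λ c → c ∈ C) ×
      (∀ c → c ∈ C → c ∉ X) ×
      Connected _~_ C ×
      (∀ u w → u ∈ C → u ~ w → w ∉ X → w ∈ C)

    N : Subset n → Subset n
    N C = tabulate λ w → ⌊ ¬? (w ∈? C) ×-dec any? (λ u → (u ∈? C) ×-dec (u ~? w)) ⌋

    -- adjacency of the torso G⟦X⟧ (restricted to X in uses below)
    TorsoAdj : Subset n → Fin n → Fin n → Set
    TorsoAdj X v w = v ≢ w × (v ~ w ⊎ (∃ λ C → IsComponent X C × v ∈ N C × w ∈ N C))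

    TorsoThreeConnected : Subset n → Set
    TorsoThreeConnected X =
      3 < ∣ X ∣ ×
      (∀ (R : Subset n) → (∀ r → r ∈ R → r ∈ X) → ∣ R ∣ ≤ 2 →
        Connected (TorsoAdj X) (X ∩ ∁ R))

    AdhesionAtMost2 : Subset n → Set
    AdhesionAtMost2 X = ∀ C → IsComponent X C → ∣ N C ∣ ≤ 2

    ProperBlock : Subset n → Set
    ProperBlock B = TorsoThreeConnected B × AdhesionAtMost2 B

module Submission where

-- If v ∉ B, the neighbourhood of the component of G − B containing v has at most two
-- vertices by the adhesion bound, and it separates v from B.  If v ∈ B and S separates v
-- from {b₁, b₂, b₃} with |S| ≤ 2, project S into B: keep its vertices in B and replace
-- each z ∉ B by one attachment of its component other than v.  The projection R still
-- has at most two vertices, so some bᵢ avoids it, and 3-connectivity of G⟦B⟧ gives a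
-- torso path from v to bᵢ avoiding R.  Every torso edge lifts to a walk of G avoiding S:
-- a virtual edge xy through a component D either runs inside D, when D misses S, or D
-- is the component of some z ∈ S, and then x or y lies in R.

open import Defs
open import Data.Nat using (ℕ; zero; suc; _+_; _≤_; _<_; _≤′_; z≤n; s≤s; ≤′-refl; ≤′-step)
import Data.Nat.Properties as ℕ
open import Data.Fin using (Fin; _≟_)
open import Data.Fin.Subset using (Subset; _∈_; _∉_; _⊆_; ∣_∣; ⁅_⁆; _∪_; _∩_; _-_; ∁; ⊤; inside; outside) renaming (⊥ to ∅)
open import Data.Fin.Subset.Properties using (⊆-antisym; _∈?_; x∈p∧x≢y⇒x∈p-y; x∈p⇒∣p-x∣<∣p∣; ∈⊤; ∣⊤∣≡n; x∈⁅x⁆; x∈⁅y⁆⇒x≡y; x∈p∪q⁻; x∈p∪q⁺; x∈p∩q⁻; x∈p∩q⁺; x∈∁p⇒x∉p; x∉p⇒x∈∁p; ∣⁅x⁆∣≡1; ∣p∩q∣≤∣q∣; ∣⊥∣≡0; ∉⊥; p⊆p∪q; q⊆p∪q)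
open import Data.Fin.Properties using (any?)
open import Data.Vec using (tabulate; []; _∷_)
open import Data.Vec.Properties using (lookup∘tabulate; []=⇒lookup; lookup⇒[]=)
open import Data.Bool.Properties using (T-≡)
open import Data.List using (List; []; _∷_; length)
open import Data.List.Relation.Unary.All using (All; []; _∷_) renaming (tail to All-tail; map to mapᴬ)
open import Data.List.Relation.Unary.All.Properties using (¬Any⇒All¬; All¬⇒¬Any)
open import Data.List.Relation.Unary.Any using (Any; here; there) renaming (any? to anyᴸ?)
open import Data.List.Relation.Unary.AllPairs using ([]; _∷_)
open import Data.List.Relation.Unary.Unique.Propositional using (Unique)
open import Data.Product using (Σ; ∃; ∃₂; _×_; _,_; proj₁; proj₂)
open import Data.Sum using (_⊎_; inj₁; inj₂; [_,_]′)
import Data.Sum as Sum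
open import Data.Empty using (⊥; ⊥-elim)
open import Relation.Nullary using (¬_; Dec; yes; no)
open import Relation.Nullary.Decidable using (⌊_⌋; _×-dec_; _⊎-dec_; ¬?; toWitness; fromWitness)
open import Relation.Binary.PropositionalEquality using (_≡_; _≢_; refl; sym; trans; subst; cong)
open import Function.Bundles using (_⇔_; mk⇔; Equivalence)
open import Function using (_∘_)

module _ {n : ℕ} where

  ∈-tabulate⁻ : ∀ {P : Fin n → Set} (P? : ∀ w → Dec (P w)) {x} →
                x ∈ tabulate (λ w → ⌊ P? w ⌋) → P x
  ∈-tabulate⁻ P? {x} x∈ =
    toWitness (Equivalence.from T-≡ (trans (sym (lookup∘tabulate (λ w → ⌊ P? w ⌋) x)) ([]=⇒lookup x∈)))

  ∈-tabulate⁺ : ∀ {P : Fin n → Set} (P? : ∀ w → Dec (P w)) {x} →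
                P x → x ∈ tabulate (λ w → ⌊ P? w ⌋)
  ∈-tabulate⁺ P? {x} px =
    lookup⇒[]= x _ (trans (lookup∘tabulate (λ w → ⌊ P? w ⌋) x) (Equivalence.to T-≡ (fromWitness px)))

  Unique⇒length≤∣p∣ : ∀ {xs : List (Fin n)} (p : Subset n) → Unique xs → All (_∈ p) xs → length xs ≤ ∣ p ∣
  Unique⇒length≤∣p∣ p [] [] = z≤n
  Unique⇒length≤∣p∣ {x ∷ xs} p (x∉xs ∷ u) (x∈p ∷ xs⊆p) =
    ℕ.≤-trans (s≤s (Unique⇒length≤∣p∣ (p - x) u (removeHead x∉xs xs⊆p))) (x∈p⇒∣p-x∣<∣p∣ x∈p)
    where
    removeHead : ∀ {ys} → All (x ≢_) ys → All (_∈ p) ys → All (_∈ p - x) ys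
    removeHead [] [] = []
    removeHead (x≢y ∷ ds) (y∈p ∷ ys⊆p) = x∈p∧x≢y⇒x∈p-y y∈p (x≢y ∘ sym) ∷ removeHead ds ys⊆p

  ∣p∣≤2⇒¬distinct³ : ∀ {p : Subset n} {x y z} → ∣ p ∣ ≤ 2 → x ≢ y → x ≢ z → y ≢ z →
                     x ∈ p → y ∈ p → z ∈ p → ⊥
  ∣p∣≤2⇒¬distinct³ {p} ∣p∣≤2 x≢y x≢z y≢z x∈p y∈p z∈p = ℕ.<-irrefl refl (ℕ.≤-trans
    (Unique⇒length≤∣p∣ p ((x≢y ∷ x≢z ∷ []) ∷ (y≢z ∷ []) ∷ [] ∷ []) (x∈p ∷ y∈p ∷ z∈p ∷ [])) ∣p∣≤2)

  ∣p∣≤2⇒∉distinct³ : ∀ {p : Subset n} {x y z} → ∣ p ∣ ≤ 2 → x ≢ y → x ≢ z → y ≢ z →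
                      x ∉ p ⊎ y ∉ p ⊎ z ∉ p
  ∣p∣≤2⇒∉distinct³ {p} {x} {y} {z} ∣p∣≤2 x≢y x≢z y≢z with x ∈? p | y ∈? p | z ∈? p
  ... | no x∉p | _ | _ = inj₁ x∉p
  ... | yes _ | no y∉p | _ = inj₂ (inj₁ y∉p)
  ... | yes _ | yes _ | no z∉p = inj₂ (inj₂ z∉p)
  ... | yes x∈p | yes y∈p | yes z∈p = ⊥-elim (∣p∣≤2⇒¬distinct³ ∣p∣≤2 x≢y x≢z y≢z x∈p y∈p z∈p)

  x∈p∩∁q⁻ : ∀ {p q : Subset n} {x} → x ∈ p ∩ ∁ q → x ∈ p × x ∉ q
  x∈p∩∁q⁻ {p} {q} x∈ = let x∈p , x∈∁q = x∈p∩q⁻ p (∁ q) x∈ in x∈p , x∈∁p⇒x∉p x∈∁q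

  x∈p∩∁q⁺ : ∀ {p q : Subset n} {x} → x ∈ p → x ∉ q → x ∈ p ∩ ∁ q
  x∈p∩∁q⁺ x∈p x∉q = x∈p∩q⁺ (x∈p , x∉p⇒x∈∁p x∉q)

  ⁅x,y,z⁆⊆p : ∀ {p : Subset n} {x y z} → x ∈ p → y ∈ p → z ∈ p → ⁅ x ⁆ ∪ ⁅ y ⁆ ∪ ⁅ z ⁆ ⊆ p
  ⁅x,y,z⁆⊆p {x = x} {y} {z} x∈p y∈p z∈p w∈ with x∈p∪q⁻ ⁅ x ⁆ (⁅ y ⁆ ∪ ⁅ z ⁆) w∈
  ... | inj₁ w∈x = subst (_∈ _) (sym (x∈⁅y⁆⇒x≡y x w∈x)) x∈p
  ... | inj₂ w∈yz with x∈p∪q⁻ ⁅ y ⁆ ⁅ z ⁆ w∈yz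
  ...   | inj₁ w∈y = subst (_∈ _) (sym (x∈⁅y⁆⇒x≡y y w∈y)) y∈p
  ...   | inj₂ w∈z = subst (_∈ _) (sym (x∈⁅y⁆⇒x≡y z w∈z)) z∈p

  ∣p∣≤2⇒⊆pair : ∀ (p : Subset n) → Fin n → ∣ p ∣ ≤ 2 → ∃₂ λ a b → ∀ {x} → x ∈ p → x ≡ a ⊎ x ≡ b
  ∣p∣≤2⇒⊆pair p d ∣p∣≤2 with any? (_∈? p)
  ... | no empty = d , d , λ {x} x∈p → ⊥-elim (empty (x , x∈p))
  ... | yes (a , a∈p) with any? (λ x → (x ∈? p) ×-dec ¬? (x ≟ a))
  ...   | no onlyA = a , a , inj₁ ∘ x≡a
    where
    x≡a : ∀ {x} → x ∈ p → x ≡ a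
    x≡a {x} x∈p with x ≟ a
    ... | yes x≡a = x≡a
    ... | no x≢a = ⊥-elim (onlyA (x , x∈p , x≢a))
  ...   | yes (b , b∈p , b≢a) = a , b , a-or-b
    where
    a-or-b : ∀ {x} → x ∈ p → x ≡ a ⊎ x ≡ b
    a-or-b {x} x∈p with x ≟ a | x ≟ b
    ... | yes x≡a | _ = inj₁ x≡a
    ... | no _ | yes x≡b = inj₂ x≡b
    ... | no x≢a | no x≢b = ⊥-elim (∣p∣≤2⇒¬distinct³ ∣p∣≤2 (b≢a ∘ sym) (x≢a ∘ sym) (x≢b ∘ sym) a∈p b∈p x∈p)

∣p∪q∣≤∣p∣+∣q∣ : ∀ {n} (p q : Subset n) → ∣ p ∪ q ∣ ≤ ∣ p ∣ + ∣ q ∣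
∣p∪q∣≤∣p∣+∣q∣ [] [] = z≤n
∣p∪q∣≤∣p∣+∣q∣ (inside ∷ p) (inside ∷ q) = s≤s (ℕ.≤-trans (∣p∪q∣≤∣p∣+∣q∣ p q) (ℕ.+-monoʳ-≤ ∣ p ∣ (ℕ.n≤1+n ∣ q ∣)))
∣p∪q∣≤∣p∣+∣q∣ (inside ∷ p) (outside ∷ q) = s≤s (∣p∪q∣≤∣p∣+∣q∣ p q)
∣p∪q∣≤∣p∣+∣q∣ (outside ∷ p) (inside ∷ q) =
  subst (suc ∣ p ∪ q ∣ ≤_) (sym (ℕ.+-suc ∣ p ∣ ∣ q ∣)) (s≤s (∣p∪q∣≤∣p∣+∣q∣ p q))
∣p∪q∣≤∣p∣+∣q∣ (outside ∷ p) (outside ∷ q) = ∣p∪q∣≤∣p∣+∣q∣ p q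

module _ {n : ℕ} {R : Fin n → Fin n → Set} where

  len : ∀ {u w} → Walk R u w → ℕ
  len [] = 0
  len (_ ∷ p) = suc (len p)

  infixr 5 _++ʷ_
  _++ʷ_ : ∀ {u v w} → Walk R u v → Walk R v w → Walk R u w
  [] ++ʷ q = q
  (e ∷ p) ++ʷ q = e ∷ (p ++ʷ q)

  reverse : (∀ {a b} → R a b → R b a) → ∀ {u w} → Walk R u w → Walk R w u
  reverse R-sym [] = []
  reverse R-sym (e ∷ p) = reverse R-sym p ++ʷ (R-sym e ∷ [])

  module _ {P : Fin n → Set} where

    All-first : ∀ {u w} (p : Walk R u w) → All P (verts p) → P u
    All-first [] (Pu ∷ _) = Pu
    All-first (_ ∷ _) (Pu ∷ _) = Pu

    All-last : ∀ {u w} (p : Walk R u w) → All P (verts p) → P w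
    All-last [] (Pw ∷ []) = Pw
    All-last (_ ∷ p) (_ ∷ Pp) = All-last p Pp

    All-++ʷ : ∀ {u v w} (p : Walk R u v) (q : Walk R v w) →
              All P (verts p) → All P (verts q) → All P (verts (p ++ʷ q))
    All-++ʷ [] q _ Pq = Pq
    All-++ʷ (_ ∷ p) q (Pu ∷ Pp) Pq = Pu ∷ All-++ʷ p q Pp Pq

    All-snoc : ∀ {u v w} (p : Walk R u v) (e : R v w) → All P (verts p) → P w → All P (verts (p ++ʷ (e ∷ [])))
    All-snoc p e Pp Pw = All-++ʷ p (e ∷ []) Pp (All-last p Pp ∷ Pw ∷ [])

    All-reverse : (R-sym : ∀ {a b} → R a b → R b a) → ∀ {u w} (p : Walk R u w) →
                  All P (verts p) → All P (verts (reverse R-sym p))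
    All-reverse R-sym [] Pp = Pp
    All-reverse R-sym (e ∷ p) (Pu ∷ Pp) = All-snoc (reverse R-sym p) (R-sym e) (All-reverse R-sym p Pp) Pu

  suffixFrom : ∀ {x u w} (q : Walk R u w) → Any (x ≡_) (verts q) →
               Σ (Walk R x w) λ r → (∀ {P : Fin n → Set} → All P (verts q) → All P (verts r)) × (IsPath q → IsPath r)
  suffixFrom [] (here refl) = [] , (λ Pq → Pq) , (λ uq → uq)
  suffixFrom (e ∷ q) (here refl) = e ∷ q , (λ Pq → Pq) , (λ uq → uq)
  suffixFrom (e ∷ q) (there x∈q) with suffixFrom q x∈q
  ... | r , All⇒ , path⇒ = r , (λ Pq → All⇒ (All-tail Pq)) , (λ { (_ ∷ uq) → path⇒ uq })

  toPath : ∀ {P : Fin n → Set} {u w} (p : Walk R u w) → All P (verts p) → Σ (Walk R u w) λ q → IsPath q × All P (verts q)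
  toPath [] Pp = [] , [] ∷ [] , Pp
  toPath {u = u} (e ∷ p) (Pu ∷ Pp) with toPath p Pp
  ... | q , q-path , Pq with anyᴸ? (u ≟_) (verts q)
  ...   | yes u∈q = let r , All⇒ , path⇒ = suffixFrom q u∈q in r , path⇒ q-path , All⇒ Pq
  ...   | no u∉q = e ∷ q , ¬Any⇒All¬ (verts q) u∉q ∷ q-path , Pu ∷ Pq

  len-verts : ∀ {u w} (p : Walk R u w) → length (verts p) ≡ suc (len p)
  len-verts [] = refl
  len-verts (_ ∷ p) = cong suc (len-verts p)

  path-len<n : ∀ {u w} (p : Walk R u w) → IsPath p → len p < n
  path-len<n p p-path = subst (_≤ n) (len-verts p)
    (subst (length (verts p) ≤_) (∣⊤∣≡n n) (Unique⇒length≤∣p∣ ⊤ p-path (all-∈⊤ (verts p))))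
    where
    all-∈⊤ : ∀ xs → All (_∈ ⊤) xs
    all-∈⊤ [] = []
    all-∈⊤ (x ∷ xs) = ∈⊤ ∷ all-∈⊤ xs

module Components {n : ℕ} (G : Graph n) (B : Subset n) where
  open Graph G

  AvoidingWalk : Fin n → Fin n → Set
  AvoidingWalk u w = Σ (Walk _~_ u w) λ p → All (_∉ B) (verts p)

  ∈N⁻ : ∀ {C x} → x ∈ N G C → x ∉ C × ∃ λ u → u ∈ C × u ~ x
  ∈N⁻ {C} = ∈-tabulate⁻ (λ w → ¬? (w ∈? C) ×-dec any? (λ u → (u ∈? C) ×-dec (u ~? w)))

  ∈N⁺ : ∀ {C x u} → x ∉ C → u ∈ C → u ~ x → x ∈ N G C
  ∈N⁺ {C} x∉C u∈C u~x =
    ∈-tabulate⁺ (λ w → ¬? (w ∈? C) ×-dec any? (λ u → (u ∈? C) ×-dec (u ~? w))) (x∉C , _ , u∈C , u~x)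

  exits-through-N : ∀ {C u x} → u ∈ C → x ∉ C → (p : Walk _~_ u x) → Any (_∈ N G C) (verts p)
  exits-through-N u∈C x∉C [] = ⊥-elim (x∉C u∈C)
  exits-through-N {C} u∈C x∉C (_∷_ {v = w} u~w p) with w ∈? C
  ... | yes w∈C = there (exits-through-N w∈C x∉C p)
  ... | no w∉C = there (Any-first p (∈N⁺ w∉C u∈C u~w))
    where
    Any-first : ∀ {P : Fin n → Set} {a b} (q : Walk _~_ a b) → P a → Any P (verts q)
    Any-first [] Pa = here Pa
    Any-first (_ ∷ _) Pa = here Pa

  Step : Subset n → Fin n → Set
  Step U w = w ∈ U ⊎ (w ∉ B × ∃ λ u → u ∈ U × u ~ w)

  step? : ∀ U w → Dec (Step U w)
  step? U w = (w ∈? U) ⊎-dec (¬? (w ∈? B) ×-dec any? (λ u → (u ∈? U) ×-dec (u ~? w)))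

  reach : Fin n → ℕ → Subset n
  reach a zero = ⁅ a ⁆
  reach a (suc k) = tabulate λ w → ⌊ step? (reach a k) w ⌋

  reach-sound : ∀ {a x} k → a ∉ B → x ∈ reach a k → AvoidingWalk a x
  reach-sound zero a∉B x∈ with x∈⁅y⁆⇒x≡y _ x∈
  ... | refl = [] , a∉B ∷ []
  reach-sound {a} (suc k) a∉B x∈ with ∈-tabulate⁻ (step? (reach a k)) x∈
  ... | inj₁ x∈ₖ = reach-sound k a∉B x∈ₖ
  ... | inj₂ (x∉B , u , u∈ₖ , u~x) =
    let p , p∉B = reach-sound k a∉B u∈ₖ in p ++ʷ (u~x ∷ []) , All-snoc p u~x p∉B x∉B

  reach-mono : ∀ {a k m} → k ≤ m → reach a k ⊆ reach a m
  reach-mono {a} k≤m = go (ℕ.≤⇒≤′ k≤m)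
    where
    go : ∀ {k m} → k ≤′ m → reach a k ⊆ reach a m
    go ≤′-refl x∈ = x∈
    go (≤′-step {m} k≤m) x∈ = ∈-tabulate⁺ (step? (reach a m)) (inj₁ (go k≤m x∈))

  reach-walk : ∀ {a u x} k → u ∈ reach a k → (p : Walk _~_ u x) → All (_∉ B) (verts p) →
               x ∈ reach a (k + len p)
  reach-walk {a} {u} k u∈ [] _ = subst (λ j → u ∈ reach a j) (sym (ℕ.+-identityʳ k)) u∈
  reach-walk {a} {x = x} k u∈ (u~w ∷ p) (_ ∷ p∉B) =
    subst (λ j → x ∈ reach a j) (sym (ℕ.+-suc k (len p)))
      (reach-walk (suc k) (∈-tabulate⁺ (step? (reach a k)) (inj₂ (All-first p p∉B , _ , u∈ , u~w))) p p∉B)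

  -- paths have fewer than n edges, so n rounds reach everything
  component : Fin n → Subset n
  component a = reach a n

  component-sound : ∀ {a x} → a ∉ B → x ∈ component a → AvoidingWalk a x
  component-sound = reach-sound n

  component-complete : ∀ {a x} → AvoidingWalk a x → x ∈ component a
  component-complete {a} (p , p∉B) =
    let q , q-path , q∉B = toPath p p∉B
    in reach-mono (ℕ.<⇒≤ (path-len<n q q-path)) (reach-walk 0 (x∈⁅x⁆ a) q q∉B)

  ∈component : ∀ a → a ∈ component a
  ∈component a = reach-mono {m = n} z≤n (x∈⁅x⁆ a)

  component⊆∁B : ∀ {a x} → a ∉ B → x ∈ component a → x ∉ B
  component⊆∁B a∉B x∈ = let p , p∉B = component-sound a∉B x∈ in All-last p p∉B

  component-closed : ∀ {a u w} → a ∉ B → u ∈ component a → u ~ w → w ∉ B → w ∈ component a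
  component-closed a∉B u∈ u~w w∉B =
    let p , p∉B = component-sound a∉B u∈ in component-complete (p ++ʷ (u~w ∷ []) , All-snoc p u~w p∉B w∉B)

  walk-within-component : ∀ {a u x} → a ∉ B → u ∈ component a → (p : Walk _~_ u x) → All (_∉ B) (verts p) →
                          All (_∈ component a) (verts p)
  walk-within-component a∉B u∈ [] _ = u∈ ∷ []
  walk-within-component a∉B u∈ (u~w ∷ p) (_ ∷ p∉B) =
    u∈ ∷ walk-within-component a∉B (component-closed a∉B u∈ u~w (All-first p p∉B)) p p∉B

  component-isComponent : ∀ {a} → a ∉ B → IsComponent G B (component a)
  component-isComponent {a} a∉B =
    (a , ∈component a) ,
    (λ _ → component⊆∁B a∉B) ,
    connected ,
    (λ u w u∈ u~w w∉B → component-closed a∉B u∈ u~w w∉B)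
    where
    connected : Connected _~_ (component a)
    connected u w u∈ w∈ =
      let pu , pu∉B = component-sound a∉B u∈
          pw , pw∉B = component-sound a∉B w∈
          p = reverse ~-sym pu ++ʷ pw
          p∉B = All-++ʷ (reverse ~-sym pu) pw (All-reverse ~-sym pu pu∉B) pw∉B
      in toPath p (walk-within-component a∉B u∈ p p∉B)

  component-unique : ∀ {D a} → IsComponent G B D → a ∈ D → D ≡ component a
  component-unique {D} {a} (_ , D⊆∁B , D-connected , D-closed) a∈D = ⊆-antisym D⊆ ⊆D
    where
    D⊆ : D ⊆ component a
    D⊆ {u} u∈D = let p , _ , p⊆D = D-connected a u a∈D u∈D in component-complete (p , mapᴬ (D⊆∁B _) p⊆D)

    stays : ∀ {x y} → x ∈ D → (p : Walk _~_ x y) → All (_∉ B) (verts p) → y ∈ D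
    stays x∈D [] _ = x∈D
    stays x∈D (x~w ∷ p) (_ ∷ p∉B) = stays (D-closed _ _ x∈D x~w (All-first p p∉B)) p p∉B

    ⊆D : component a ⊆ D
    ⊆D u∈ = let p , p∉B = component-sound (D⊆∁B a a∈D) u∈ in stays a∈D p p∉B

  N-component⊆B : ∀ {D} → IsComponent G B D → N G D ⊆ B
  N-component⊆B {D} (_ , _ , _ , D-closed) {x} x∈N with x ∈? B
  ... | yes x∈B = x∈B
  ... | no x∉B = let x∉D , u , u∈D , u~x = ∈N⁻ x∈N in ⊥-elim (x∉D (D-closed u x u∈D u~x x∉B))

  separator-outside : AdhesionAtMost2 G B → ∀ {v X} → v ∉ B → (∀ {x} → x ∈ X → x ∈ B) →
                      ∃ λ S → ∣ S ∣ ≤ 2 × Separates G S v X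
  separator-outside adhesion {v} v∉B X⊆B =
    N G (component v) ,
    adhesion _ (component-isComponent v∉B) ,
    (λ v∈N → proj₁ (∈N⁻ v∈N) (∈component v)) ,
    λ x x∈X p _ → exits-through-N (∈component v) (λ x∈C → component⊆∁B v∉B x∈C (X⊆B x∈X)) p

  -- R ⊆ B blocks in the torso G⟦B⟧ whatever z blocks in G
  Shields : Subset n → Fin n → Set
  Shields R z = (z ∈ B → z ∈ R) ×
    (z ∉ B → ∀ {x y} → x ≢ y → x ∈ N G (component z) → y ∈ N G (component z) → x ∈ R ⊎ y ∈ R)

  Shields-mono : ∀ {R R′ z} → R ⊆ R′ → Shields R z → Shields R′ z
  Shields-mono R⊆R′ (hits , blocks) =
    (λ z∈B → R⊆R′ (hits z∈B)) ,
    (λ z∉B x≢y x∈N y∈N → Sum.map R⊆R′ R⊆R′ (blocks z∉B x≢y x∈N y∈N))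

  module _ {S R : Subset n} (shields : ∀ {z} → z ∈ S → Shields R z) where

    ∉S : ∀ {x} → x ∈ B ∩ ∁ R → x ∉ S
    ∉S x∈ x∈S = let x∈B , x∉R = x∈p∩∁q⁻ x∈ in x∉R (proj₁ (shields x∈S) x∈B)

    torso-edge-lift : ∀ {x y} → x ∈ B ∩ ∁ R → y ∈ B ∩ ∁ R → TorsoAdj G B x y →
                      Σ (Walk _~_ x y) λ p → All (_∉ S) (verts p)
    torso-edge-lift x∈ y∈ (_ , inj₁ x~y) = x~y ∷ [] , ∉S x∈ ∷ ∉S y∈ ∷ []
    torso-edge-lift x∈ y∈ (x≢y , inj₂ (D , D-comp , x∈N , y∈N))
      with any? (λ z → (z ∈? S) ×-dec (z ∈? D))
    ... | yes (z , z∈S , z∈D) with component-unique D-comp z∈D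
    ...   | refl = ⊥-elim ([ proj₂ (x∈p∩∁q⁻ x∈) , proj₂ (x∈p∩∁q⁻ y∈) ]′
                           (proj₂ (shields z∈S) (proj₁ (proj₂ D-comp) z z∈D) x≢y x∈N y∈N))
    torso-edge-lift x∈ y∈ (x≢y , inj₂ (D , D-comp , x∈N , y∈N))
      | no S-misses-D =
      let _ , c , c∈D , c~x = ∈N⁻ x∈N
          _ , d , d∈D , d~y = ∈N⁻ y∈N
          p , _ , p⊆D = proj₁ (proj₂ (proj₂ D-comp)) c d c∈D d∈D
          ∉S-in-D : ∀ {w} → w ∈ D → w ∉ S
          ∉S-in-D {w} w∈D w∈S = S-misses-D (w , w∈S , w∈D)
      in ~-sym c~x ∷ p ++ʷ (d~y ∷ []) ,
         ∉S x∈ ∷ All-snoc p d~y (mapᴬ ∉S-in-D p⊆D) (∉S y∈)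

    torso-walk-lift : ∀ {x y} (p : Walk (TorsoAdj G B) x y) → All (_∈ B ∩ ∁ R) (verts p) →
                      Σ (Walk _~_ x y) λ q → All (_∉ S) (verts q)
    torso-walk-lift [] (x∈ ∷ []) = [] , ∉S x∈ ∷ []
    torso-walk-lift (e ∷ p) (x∈ ∷ p∈) =
      let q₁ , q₁∉S = torso-edge-lift x∈ (All-first p p∈) e
          q₂ , q₂∉S = torso-walk-lift p p∈
      in q₁ ++ʷ q₂ , All-++ʷ q₁ q₂ q₁∉S q₂∉S

  module _ (adhesion : AdhesionAtMost2 G B) {v : Fin n} {S : Subset n} (v∉S : v ∉ S) where

    record Shadow (z : Fin n) : Set where
      field
        vertices : Subset n
        size : ∣ vertices ∣ ≤ 1
        ⊆B : vertices ⊆ B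
        v∉ : v ∉ vertices
        shields : z ∈ S → Shields vertices z

    shadow : ∀ z → Shadow z
    shadow z with z ∈? B
    ... | yes z∈B = record
      { vertices = S ∩ ⁅ z ⁆
      ; size = subst (∣ S ∩ ⁅ z ⁆ ∣ ≤_) (∣⁅x⁆∣≡1 z) (∣p∩q∣≤∣q∣ S ⁅ z ⁆)
      ; ⊆B = λ x∈ → subst (_∈ B) (sym (x∈⁅y⁆⇒x≡y z (proj₂ (x∈p∩q⁻ S ⁅ z ⁆ x∈)))) z∈B
      ; v∉ = λ v∈ → v∉S (proj₁ (x∈p∩q⁻ S ⁅ z ⁆ v∈))
      ; shields = λ z∈S → (λ _ → x∈p∩q⁺ (z∈S , x∈⁅x⁆ z)) , (λ z∉B → ⊥-elim (z∉B z∈B))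
      }
    ... | no z∉B with any? (λ r → (r ∈? N G (component z)) ×-dec ¬? (r ≟ v))
    ...   | yes (r , r∈N , r≢v) = record
      { vertices = ⁅ r ⁆
      ; size = ℕ.≤-reflexive (∣⁅x⁆∣≡1 r)
      ; ⊆B = λ x∈ → subst (_∈ B) (sym (x∈⁅y⁆⇒x≡y r x∈)) (N-component⊆B (component-isComponent z∉B) r∈N)
      ; v∉ = λ v∈ → r≢v (sym (x∈⁅y⁆⇒x≡y r v∈))
      ; shields = λ _ → (λ z∈B → ⊥-elim (z∉B z∈B)) , blocks
      }
      where
      blocks : z ∉ B → ∀ {x y} → x ≢ y → x ∈ N G (component z) → y ∈ N G (component z) → x ∈ ⁅ r ⁆ ⊎ y ∈ ⁅ r ⁆
      blocks _ {x} {y} x≢y x∈N y∈N with x ≟ r | y ≟ r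
      ... | yes refl | _ = inj₁ (x∈⁅x⁆ r)
      ... | no _ | yes refl = inj₂ (x∈⁅x⁆ r)
      ... | no x≢r | no y≢r =
        ⊥-elim (∣p∣≤2⇒¬distinct³ (adhesion _ (component-isComponent z∉B)) x≢y x≢r y≢r x∈N y∈N r∈N)
    ...   | no onlyV = record
      { vertices = ∅
      ; size = subst (_≤ 1) (sym (∣⊥∣≡0 n)) z≤n
      ; ⊆B = λ x∈ → ⊥-elim (∉⊥ x∈)
      ; v∉ = ∉⊥
      ; shields = λ _ → (λ z∈B → ⊥-elim (z∉B z∈B)) , blocks
      }
      where
      blocks : z ∉ B → ∀ {x y} → x ≢ y → x ∈ N G (component z) → y ∈ N G (component z) → x ∈ ∅ ⊎ y ∈ ∅
      blocks _ {x} {y} x≢y x∈N y∈N with x ≟ v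
      ... | yes refl = ⊥-elim (onlyV (y , y∈N , x≢y ∘ sym))
      ... | no x≢v = ⊥-elim (onlyV (x , x∈N , x≢v))

    shield : ∣ S ∣ ≤ 2 → ∃ λ R → R ⊆ B × ∣ R ∣ ≤ 2 × v ∉ R × (∀ {z} → z ∈ S → Shields R z)
    shield ∣S∣≤2 with ∣p∣≤2⇒⊆pair S v ∣S∣≤2
    ... | a , b , S⊆ab = Fa ∪ Fb , ∪⊆B , ∣∪∣≤2 , v∉∪ , shields∪
      where
      open Shadow (shadow a) renaming (vertices to Fa; size to ∣Fa∣≤1; ⊆B to Fa⊆B; v∉ to v∉Fa; shields to Fa-shields)
      open Shadow (shadow b) renaming (vertices to Fb; size to ∣Fb∣≤1; ⊆B to Fb⊆B; v∉ to v∉Fb; shields to Fb-shields)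

      ∪⊆B : Fa ∪ Fb ⊆ B
      ∪⊆B x∈ = [ Fa⊆B , Fb⊆B ]′ (x∈p∪q⁻ Fa Fb x∈)

      ∣∪∣≤2 : ∣ Fa ∪ Fb ∣ ≤ 2
      ∣∪∣≤2 = ℕ.≤-trans (∣p∪q∣≤∣p∣+∣q∣ Fa Fb) (ℕ.+-mono-≤ ∣Fa∣≤1 ∣Fb∣≤1)

      v∉∪ : v ∉ Fa ∪ Fb
      v∉∪ v∈ = [ v∉Fa , v∉Fb ]′ (x∈p∪q⁻ Fa Fb v∈)

      shields∪ : ∀ {z} → z ∈ S → Shields (Fa ∪ Fb) z
      shields∪ z∈S with S⊆ab z∈S
      ... | inj₁ refl = Shields-mono (p⊆p∪q Fb) (Fa-shields z∈S)
      ... | inj₂ refl = Shields-mono (q⊆p∪q Fa Fb) (Fb-shields z∈S)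

  block-inseparable : ProperBlock G B → ∀ {v X x y z} → v ∈ B →
                      x ≢ y → x ≢ z → y ≢ z → x ∈ X → y ∈ X → z ∈ X → x ∈ B → y ∈ B → z ∈ B →
                      ¬ ∃ λ S → ∣ S ∣ ≤ 2 × Separates G S v X
  block-inseparable ((_ , torso-connected) , adhesion) {v} {X} v∈B x≢y x≢z y≢z x∈X y∈X z∈X x∈B y∈B z∈B
                    (S , ∣S∣≤2 , v∉S , separates)
    with shield adhesion v∉S ∣S∣≤2
  ... | R , R⊆B , ∣R∣≤2 , v∉R , shields =
    [ reaches x∈X x∈B , [ reaches y∈X y∈B , reaches z∈X z∈B ]′ ]′ (∣p∣≤2⇒∉distinct³ ∣R∣≤2 x≢y x≢z y≢z)
    where
    reaches : ∀ {t} → t ∈ X → t ∈ B → t ∉ R → ⊥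
    reaches {t} t∈X t∈B t∉R =
      let p , _ , p⊆B∖R = torso-connected R (λ _ → R⊆B) ∣R∣≤2 v t (x∈p∩∁q⁺ v∈B v∉R) (x∈p∩∁q⁺ t∈B t∉R)
          q , q∉S = torso-walk-lift shields p p⊆B∖R
          r , r-path , r∉S = toPath q q∉S
      in All¬⇒¬Any r∉S (separates t t∈X r r-path)

lemma11 : ∀ {n : ℕ} (G : Graph n) (B : Subset n) → ProperBlock G B →
    (b₁ b₂ b₃ : Fin n) → b₁ ∈ B → b₂ ∈ B → b₃ ∈ B →
    b₁ ≢ b₂ → b₁ ≢ b₃ → b₂ ≢ b₃ →
    ∀ (v : Fin n) →
      (v ∈ B ⇔ (¬ ∃ λ (S : Subset n) → ∣ S ∣ ≤ 2 × Separates G S v (⁅ b₁ ⁆ ∪ ⁅ b₂ ⁆ ∪ ⁅ b₃ ⁆)))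
lemma11 G B block b₁ b₂ b₃ b₁∈B b₂∈B b₃∈B b₁≢b₂ b₁≢b₃ b₂≢b₃ v = mk⇔ ∈B⇒inseparable inseparable⇒∈B
  where
  open Components G B

  ∈B⇒inseparable : v ∈ B → ¬ ∃ λ S → ∣ S ∣ ≤ 2 × Separates G S v (⁅ b₁ ⁆ ∪ ⁅ b₂ ⁆ ∪ ⁅ b₃ ⁆)
  ∈B⇒inseparable v∈B = block-inseparable block v∈B b₁≢b₂ b₁≢b₃ b₂≢b₃
                 (x∈p∪q⁺ (inj₁ (x∈⁅x⁆ b₁)))
                 (x∈p∪q⁺ (inj₂ (x∈p∪q⁺ (inj₁ (x∈⁅x⁆ b₂)))))
                 (x∈p∪q⁺ (inj₂ (x∈p∪q⁺ (inj₂ (x∈⁅x⁆ b₃)))))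
                 b₁∈B b₂∈B b₃∈B

  inseparable⇒∈B : (¬ ∃ λ S → ∣ S ∣ ≤ 2 × Separates G S v (⁅ b₁ ⁆ ∪ ⁅ b₂ ⁆ ∪ ⁅ b₃ ⁆)) → v ∈ B
  inseparable⇒∈B inseparable with v ∈? B
  ... | yes v∈B = v∈B
  ... | no v∉B = ⊥-elim (inseparable (separator-outside (proj₂ block) v∉B (⁅x,y,z⁆⊆p b₁∈B b₂∈B b₃∈B)))
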